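{- Let the alphabet be $\mathcal{A}=\{0,1,\dots,q-1\}$ with $G=\mathbb{Z}_q$ acting by $g\cdot i=g+i\pmod q$ letterwise on words. Let $p_1$ be a pattern of length $\ell\ge2$ and $p_2$ another pattern of length at least $2$. Then for $0\le i\le \ell-2$, $\mathcal{C}_i(p_1,p_2)=C_i(S(p_1),S(p_2))$, and $\mathcal{C}_{\ell-1}(p_1,p_2)=1$.
   Context: A pattern is a $G$-orbit of words, represented by its lexicographically least word; $G_p$ denotes the stabilizer of the words of $p$. For patterns $p$ (length $\ell$) and $p'$, $\mathcal{C}(p,p')=(\mathcal{C}_0,\dots,\mathcal{C}_{\ell-1})$ where $\mathcal{C}_i=|G_x|/|G_p|$ if the suffix $x=p(i+1,\ell)$ of length $\ell-i$ is in the same $G$-orbit as the prefix of $p'$ of length $\ell-i$, and $\mathcal{C}_i=0$ otherwise. For words $v$ (length $m$) and $w$, $C(v,w)=(C_0,\dots,C_{m-1})$ with $C_i=1$ if the suffix of $v$ of length $m-i$ equals the prefix of $w$ of length $m-i$, and $C_i=0$ otherwise. The adjacency signature of $p=p(1)\cdots p(\ell)$ is the word $S(p)=s(1)\cdots s(\ell-1)$ with $s(i)\equiv p(i+1)-p(i)\pmod q$. -}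

module Defs where

open import Data.Nat using (ℕ; zero; suc; _+_; _∸_; NonZero)
open import Data.Nat.DivMod using (_%_; _/_; m%n<n)
open import Data.Fin as F using (Fin; toℕ; fromℕ<)
open import Data.Fin.Properties using (any?) renaming (_≟_ to _≟F_)
open import Data.List using (List; []; _∷_; map; length; take; drop; filter; allFin)
open import Data.List.Properties using (≡-dec)
open import Data.Product using (∃)
open import Data.Bool using (Bool; if_then_else_)
open import Relation.Nullary using (Dec; does)
open import Relation.Binary.PropositionalEquality using (_≡_)
import Data.List.Relation.Binary.Lex.NonStrict as LexNS

Word : ℕ → Set
Word q = List (Fin q)

module _ {q : ℕ} .{{_ : NonZero q}} where

  actL : Fin q → Fin q → Fin q
  actL g i = fromℕ< (m%n<n (toℕ g + toℕ i) q)

  act : Fin q → Word q → Word q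
  act g w = map (actL g) w

  _≟W_ : (v w : Word q) → Dec (v ≡ w)
  _≟W_ = ≡-dec _≟F_

  _≤lex_ : Word q → Word q → Set
  _≤lex_ = LexNS.Lex-≤ _≡_ F._<_

  IsPattern : Word q → Set
  IsPattern p = ∀ (g : Fin q) → p ≤lex act g p

  sameOrbit? : (v w : Word q) → Dec (∃ λ (g : Fin q) → act g v ≡ w)
  sameOrbit? v w = any? (λ g → act g v ≟W w)

  stabSize : Word q → ℕ
  stabSize w = length (filter (λ g → act g w ≟W w) (allFin q))

  -- natural-number division, guarded at 0 (|G_p| ≥ 1 always, so the guard is never used)
  _÷_ : ℕ → ℕ → ℕ
  m ÷ zero = 0
  m ÷ suc n = m / suc n

  -- 𝒞_i(p, p') : suffix x = p(i+1..ℓ) of length ℓ-i vs. prefix of p' of length ℓ-i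
  corrPat : ℕ → Word q → Word q → ℕ
  corrPat i p p' =
    if does (sameOrbit? (drop i p) (take (length p ∸ i) p'))
    then stabSize (drop i p) ÷ stabSize p
    else 0

  corrWord : ℕ → Word q → Word q → ℕ
  corrWord i v w = if does (drop i v ≟W take (length v ∸ i) w) then 1 else 0

  diffL : Fin q → Fin q → Fin q
  diffL a b = fromℕ< (m%n<n (toℕ b + (q ∸ toℕ a)) q)

  sig : Word q → Word q
  sig [] = []
  sig (a ∷ []) = []
  sig (a ∷ b ∷ r) = diffL a b ∷ sig (b ∷ r)

-- The action of ℤ_q on letters is simply transitive, so every nonempty word has trivial
-- stabilizer (all the ratios |G_x|/|G_p| are 1), and two nonempty words lie in the same orbit
-- exactly when their signatures agree: the signature is invariant, and conversely the shift
-- matching the first letters propagates along the word because consecutive differences agree.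
-- Signatures commute with suffixes and prefixes (a prefix of length k+1 has signature of length k),
-- which turns the orbit test in 𝒞_i into the equality test in C_i on the signatures. For i = ℓ-1
-- both words are single letters, hence in one orbit.
module Submission where

open import Defs
open import Data.Nat using (ℕ; zero; suc; _≤_; _<_; _∸_; _+_; NonZero; s≤s)
open import Data.Nat.Properties
  using (+-comm; +-assoc; +-∸-assoc; m∸n+n≡m; <⇒≤; m∸n≤m; ≤-refl; ≤-trans; n∸n≡0; +-commutativeSemigroup)
open import Data.Nat.DivMod using (_%_; %-distribˡ-+; [m+n]%n≡m%n; m%n%n≡m%n; m<n⇒m%n≡m)
open import Algebra.Properties.CommutativeSemigroup +-commutativeSemigroup using (x∙yz≈y∙xz)
open import Data.Fin as F using (Fin; toℕ)
open import Data.Fin.Properties using (toℕ-injective; toℕ-fromℕ<; toℕ<n)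
open import Data.List using (List; []; _∷_; length; take; drop; filter; tabulate)
open import Data.List.Properties using (filter-accept; filter-none; ∷-injective; drop-all)
open import Data.List.Relation.Unary.All.Properties using (tabulate⁺)
open import Data.Product using (_×_; _,_; ∃; ∃₂; proj₁)
open import Data.Bool using (if_then_else_)
open import Function.Bundles using (_⇔_; mk⇔)
open import Relation.Nullary using (Dec; does)
open import Relation.Nullary.Decidable using (does-⇔)
import Data.Empty.Irrelevant as Irrelevant
open import Relation.Binary.PropositionalEquality
open ≡-Reasoning

module _ {q : ℕ} .{{_ : NonZero q}} where

  %-absorbˡ : ∀ m n → (m % q + n) % q ≡ (m + n) % q
  %-absorbˡ m n = begin
    (m % q + n) % q          ≡⟨ %-distribˡ-+ (m % q) n q ⟩
    (m % q % q + n % q) % q  ≡⟨ cong (λ t → (t + n % q) % q) (m%n%n≡m%n m q) ⟩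
    (m % q + n % q) % q      ≡⟨ %-distribˡ-+ m n q ⟨
    (m + n) % q              ∎

  %-absorbʳ : ∀ m n → (m + n % q) % q ≡ (m + n) % q
  %-absorbʳ m n = begin
    (m + n % q) % q  ≡⟨ cong (_% q) (+-comm m (n % q)) ⟩
    (n % q + m) % q  ≡⟨ %-absorbˡ n m ⟩
    (n + m) % q      ≡⟨ cong (_% q) (+-comm n m) ⟩
    (m + n) % q      ∎

  toℕ%q≡toℕ : (a : Fin q) → toℕ a % q ≡ toℕ a
  toℕ%q≡toℕ a = m<n⇒m%n≡m (toℕ<n a)

  q∸toℕ+toℕ≡q : (a : Fin q) → q ∸ toℕ a + toℕ a ≡ q
  q∸toℕ+toℕ≡q a = m∸n+n≡m (<⇒≤ (toℕ<n a))

  toℕ-actL : ∀ g a → toℕ (actL g a) ≡ (toℕ g + toℕ a) % q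
  toℕ-actL g a = toℕ-fromℕ< _

  toℕ-diffL : ∀ a b → toℕ (diffL a b) ≡ (toℕ b + (q ∸ toℕ a)) % q
  toℕ-diffL a b = toℕ-fromℕ< _

  actL-diffL : ∀ a c → actL (diffL a c) a ≡ c
  actL-diffL a c = toℕ-injective (begin
    toℕ (actL (diffL a c) a)                   ≡⟨ toℕ-actL (diffL a c) a ⟩
    (toℕ (diffL a c) + toℕ a) % q              ≡⟨ cong (λ t → (t + toℕ a) % q) (toℕ-diffL a c) ⟩
    ((toℕ c + (q ∸ toℕ a)) % q + toℕ a) % q    ≡⟨ %-absorbˡ (toℕ c + (q ∸ toℕ a)) (toℕ a) ⟩
    (toℕ c + (q ∸ toℕ a) + toℕ a) % q          ≡⟨ cong (_% q) (+-assoc (toℕ c) _ _) ⟩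
    (toℕ c + (q ∸ toℕ a + toℕ a)) % q          ≡⟨ cong (λ t → (toℕ c + t) % q) (q∸toℕ+toℕ≡q a) ⟩
    (toℕ c + q) % q                            ≡⟨ [m+n]%n≡m%n (toℕ c) q ⟩
    toℕ c % q                                  ≡⟨ toℕ%q≡toℕ c ⟩
    toℕ c                                      ∎)

  diffL-actL : ∀ g a → diffL a (actL g a) ≡ g
  diffL-actL g a = toℕ-injective (begin
    toℕ (diffL a (actL g a))                   ≡⟨ toℕ-diffL a (actL g a) ⟩
    (toℕ (actL g a) + (q ∸ toℕ a)) % q         ≡⟨ cong (λ t → (t + (q ∸ toℕ a)) % q) (toℕ-actL g a) ⟩
    ((toℕ g + toℕ a) % q + (q ∸ toℕ a)) % q    ≡⟨ %-absorbˡ (toℕ g + toℕ a) (q ∸ toℕ a) ⟩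
    (toℕ g + toℕ a + (q ∸ toℕ a)) % q          ≡⟨ cong (_% q) (+-assoc (toℕ g) _ _) ⟩
    (toℕ g + (toℕ a + (q ∸ toℕ a))) % q        ≡⟨ cong (λ t → (toℕ g + t) % q) (+-comm (toℕ a) _) ⟩
    (toℕ g + (q ∸ toℕ a + toℕ a)) % q          ≡⟨ cong (λ t → (toℕ g + t) % q) (q∸toℕ+toℕ≡q a) ⟩
    (toℕ g + q) % q                            ≡⟨ [m+n]%n≡m%n (toℕ g) q ⟩
    toℕ g % q                                  ≡⟨ toℕ%q≡toℕ g ⟩
    toℕ g                                      ∎)

  actL-cancelʳ : ∀ {g h} a → actL g a ≡ actL h a → g ≡ h
  actL-cancelʳ {g} {h} a e = begin
    g                  ≡⟨ diffL-actL g a ⟨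
    diffL a (actL g a) ≡⟨ cong (diffL a) e ⟩
    diffL a (actL h a) ≡⟨ diffL-actL h a ⟩
    h                  ∎

  actL-comm : ∀ g h a → actL g (actL h a) ≡ actL h (actL g a)
  actL-comm g h a = toℕ-injective (begin
    toℕ (actL g (actL h a))          ≡⟨ toℕ-actL g (actL h a) ⟩
    (toℕ g + toℕ (actL h a)) % q     ≡⟨ cong (λ t → (toℕ g + t) % q) (toℕ-actL h a) ⟩
    (toℕ g + (toℕ h + toℕ a) % q) % q ≡⟨ %-absorbʳ (toℕ g) _ ⟩
    (toℕ g + (toℕ h + toℕ a)) % q    ≡⟨ cong (_% q) (x∙yz≈y∙xz (toℕ g) (toℕ h) (toℕ a)) ⟩
    (toℕ h + (toℕ g + toℕ a)) % q    ≡⟨ %-absorbʳ (toℕ h) _ ⟨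
    (toℕ h + (toℕ g + toℕ a) % q) % q ≡⟨ cong (λ t → (toℕ h + t) % q) (toℕ-actL g a) ⟨
    (toℕ h + toℕ (actL g a)) % q     ≡⟨ toℕ-actL h (actL g a) ⟨
    toℕ (actL h (actL g a))          ∎)

  diffL-actL-actL : ∀ g a b → diffL (actL g a) (actL g b) ≡ diffL a b
  diffL-actL-actL g a b = begin
    diffL (actL g a) (actL g b)                    ≡⟨ cong (λ t → diffL (actL g a) (actL g t)) (actL-diffL a b) ⟨
    diffL (actL g a) (actL g (actL (diffL a b) a)) ≡⟨ cong (diffL (actL g a)) (actL-comm g (diffL a b) a) ⟩
    diffL (actL g a) (actL (diffL a b) (actL g a)) ≡⟨ diffL-actL (diffL a b) (actL g a) ⟩
    diffL a b                                      ∎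

  actL-step : ∀ {g a b c e} → actL g a ≡ c → diffL a b ≡ diffL c e → actL g b ≡ e
  actL-step {g} {a} {b} {c} {e} ga≡c ab≡ce = begin
    actL g b                          ≡⟨ cong (actL g) (actL-diffL a b) ⟨
    actL g (actL (diffL a b) a)       ≡⟨ actL-comm g (diffL a b) a ⟩
    actL (diffL a b) (actL g a)       ≡⟨ cong₂ actL ab≡ce ga≡c ⟩
    actL (diffL c e) c                ≡⟨ actL-diffL c e ⟩
    e                                 ∎

  sig-act : ∀ g (w : Word q) → sig (act g w) ≡ sig w
  sig-act g []          = refl
  sig-act g (a ∷ [])    = refl
  sig-act g (a ∷ b ∷ w) = cong₂ _∷_ (diffL-actL-actL g a b) (sig-act g (b ∷ w))

  act-∷-from-sig : ∀ {g a c} (x y : Word q) → actL g a ≡ c →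
                   sig (a ∷ x) ≡ sig (c ∷ y) → act g (a ∷ x) ≡ c ∷ y
  act-∷-from-sig []      []      ga≡c _ = cong (_∷ []) ga≡c
  act-∷-from-sig {g} {a} {c} (b ∷ x) (e ∷ y) ga≡c s with ∷-injective s
  ... | ab≡ce , s′ = cong₂ _∷_ ga≡c (act-∷-from-sig x y (actL-step {g} {a} {b} {c} {e} ga≡c ab≡ce) s′)

  sameOrbit-∷⇔sig : ∀ a c (x y : Word q) →
                    (∃ λ g → act g (a ∷ x) ≡ c ∷ y) ⇔ (sig (a ∷ x) ≡ sig (c ∷ y))
  sameOrbit-∷⇔sig a c x y = mk⇔
    (λ (g , e) → trans (sym (sig-act g (a ∷ x))) (cong sig e))
    (λ s → diffL a c , act-∷-from-sig x y (actL-diffL a c) s)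

  sig-drop : ∀ i (w : Word q) → sig (drop i w) ≡ drop i (sig w)
  sig-drop zero          w           = refl
  sig-drop (suc i)       []          = refl
  sig-drop (suc zero)    (a ∷ [])    = refl
  sig-drop (suc (suc i)) (a ∷ [])    = refl
  sig-drop (suc i)       (a ∷ b ∷ w) = sig-drop i (b ∷ w)

  sig-take : ∀ k (w : Word q) → sig (take (suc k) w) ≡ take k (sig w)
  sig-take zero    []          = refl
  sig-take (suc k) []          = refl
  sig-take zero    (a ∷ [])    = refl
  sig-take (suc k) (a ∷ [])    = refl
  sig-take zero    (a ∷ b ∷ w) = refl
  sig-take (suc k) (a ∷ b ∷ w) = cong (diffL a b ∷_) (sig-take k (b ∷ w))

  length-sig-∷ : ∀ a (w : Word q) → length (sig (a ∷ w)) ≡ length w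
  length-sig-∷ a []      = refl
  length-sig-∷ a (b ∷ w) = cong suc (length-sig-∷ b w)

  corrWord-length : (v w : Word q) → corrWord (length v) v w ≡ 1
  corrWord-length v w
    rewrite drop-all (length v) v ≤-refl | n∸n≡0 (length v) = refl

drop-nonempty : ∀ {A : Set} i (w : List A) → i < length w → ∃₂ λ b x → drop i w ≡ b ∷ x
drop-nonempty zero    (b ∷ w) _         = b , w , refl
drop-nonempty (suc i) (_ ∷ w) (s≤s i<ℓ) = drop-nonempty i w i<ℓ

module _ {n : ℕ} where

  actL-zero : (a : Fin (suc n)) → actL F.zero a ≡ a
  actL-zero a = toℕ-injective (trans (toℕ-actL F.zero a) (toℕ%q≡toℕ a))

  act-zero : (w : Word (suc n)) → act F.zero w ≡ w
  act-zero []      = refl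
  act-zero (a ∷ w) = cong₂ _∷_ (actL-zero a) (act-zero w)

  stabSize-∷ : ∀ a (w : Word (suc n)) → stabSize (a ∷ w) ≡ 1
  stabSize-∷ a w = cong length (begin
    filter stabilizes (F.zero ∷ tabulate F.suc) ≡⟨ filter-accept stabilizes (act-zero (a ∷ w)) ⟩
    F.zero ∷ filter stabilizes (tabulate F.suc) ≡⟨ cong (F.zero ∷_) (filter-none stabilizes (tabulate⁺ suc-moves)) ⟩
    F.zero ∷ []                                 ∎)
    where
    stabilizes : (g : Fin (suc n)) → Dec (act g (a ∷ w) ≡ a ∷ w)
    stabilizes g = act g (a ∷ w) ≟W (a ∷ w)
    suc-moves : ∀ i → act (F.suc i) (a ∷ w) ≢ a ∷ w
    suc-moves i e with actL-cancelʳ {g = F.suc i} {h = F.zero} a (trans (proj₁ (∷-injective e)) (sym (actL-zero a)))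
    ... | ()

  corrPat-∷ : ∀ i (a c : Fin (suc n)) w y → i ≤ length w →
              corrPat i (a ∷ w) (c ∷ y)
                ≡ (if does (sig (drop i (a ∷ w)) ≟W sig (take (suc (length w) ∸ i) (c ∷ y))) then 1 else 0)
  corrPat-∷ i a c w y i≤ℓ with drop-nonempty i (a ∷ w) (s≤s i≤ℓ)
  ... | b , x , eq rewrite eq | +-∸-assoc 1 i≤ℓ | stabSize-∷ b x | stabSize-∷ a w =
    cong (λ t → if t then 1 else 0) (does-⇔ (sameOrbit-∷⇔sig b c x y′) (sameOrbit? (b ∷ x) (c ∷ y′))
                                            (sig (b ∷ x) ≟W sig (c ∷ y′)))
    where
    y′ : Word (suc n)
    y′ = take (length w ∸ i) y

  corrPat≡corrWord : ∀ i (a c : Fin (suc n)) w y → i ≤ length w →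
                     corrPat i (a ∷ w) (c ∷ y) ≡ corrWord i (sig (a ∷ w)) (sig (c ∷ y))
  corrPat≡corrWord i a c w y i≤ℓ = begin
    corrPat i (a ∷ w) (c ∷ y)
      ≡⟨ corrPat-∷ i a c w y i≤ℓ ⟩
    test (sig (drop i (a ∷ w))) (sig (take (suc (length w) ∸ i) (c ∷ y)))
      ≡⟨ cong₂ test (sig-drop i (a ∷ w)) sig-prefix ⟩
    test (drop i (sig (a ∷ w))) (take (length w ∸ i) (sig (c ∷ y)))
      ≡⟨ cong (λ t → test (drop i (sig (a ∷ w))) (take (t ∸ i) (sig (c ∷ y)))) (length-sig-∷ a w) ⟨
    corrWord i (sig (a ∷ w)) (sig (c ∷ y))
      ∎
    where
    test : Word (suc n) → Word (suc n) → ℕ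
    test u v = if does (u ≟W v) then 1 else 0
    sig-prefix : sig (take (suc (length w) ∸ i) (c ∷ y)) ≡ take (length w ∸ i) (sig (c ∷ y))
    sig-prefix = trans (cong (λ t → sig (take t (c ∷ y))) (+-∸-assoc 1 i≤ℓ)) (sig-take (length w ∸ i) (c ∷ y))

mainTheorem8 : (q : ℕ) .{{_ : NonZero q}} (p₁ p₂ : Word q)
    → IsPattern p₁ → IsPattern p₂
    → 2 ≤ length p₁ → 2 ≤ length p₂
    → (∀ (i : ℕ) → i ≤ length p₁ ∸ 2
         → corrPat i p₁ p₂ ≡ corrWord i (sig p₁) (sig p₂))
      × (corrPat (length p₁ ∸ 1) p₁ p₂ ≡ 1)
mainTheorem8 zero {{q≢0}} _ _ _ _ _ _ = Irrelevant.⊥-elim (NonZero.nonZero q≢0)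
mainTheorem8 (suc n) (a ∷ w) (c ∷ y) _ _ _ _ =
  (λ i i≤ℓ∸2 → corrPat≡corrWord i a c w y (≤-trans i≤ℓ∸2 (m∸n≤m (length w) 1))) ,
  (begin
    corrPat (length w) (a ∷ w) (c ∷ y)                    ≡⟨ corrPat≡corrWord (length w) a c w y ≤-refl ⟩
    corrWord (length w) (sig (a ∷ w)) (sig (c ∷ y))        ≡⟨ cong (λ t → corrWord t (sig (a ∷ w)) (sig (c ∷ y))) (length-sig-∷ a w) ⟨
    corrWord (length (sig (a ∷ w))) (sig (a ∷ w)) (sig (c ∷ y)) ≡⟨ corrWord-length (sig (a ∷ w)) (sig (c ∷ y)) ⟩
    1                                                      ∎)
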